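{- Let $G$ be a connected graph of order $n$ which is not a complete graph. If $G$ is $k$-metric dimensional, then $k\le n-\omega(G)+1$, where $\omega(G)$ is the clique number of $G$.
   Context: Graphs are finite, simple, connected; $d_G$ is the shortest-path distance. A vertex $w$ distinguishes $x,y$ if $d_G(x,w)\ne d_G(y,w)$; a set $S\subseteq V(G)$ is a $k$-metric generator if every pair of distinct vertices is distinguished by at least $k$ elements of $S$; $G$ is $k$-metric dimensional if $k$ is the largest integer for which a $k$-metric generator exists. $\omega(G)$ is the maximum cardinality of a set of pairwise adjacent vertices. -}

module Defs where

open import Level using (0ℓ)
open import Data.Nat using (ℕ; zero; suc; _≤_; _<_)
open import Data.Fin using (Fin)
open import Data.Fin.Subset using (Subset; _∈_)
open import Data.Product using (Σ; ∃; _×_; _,_)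
open import Relation.Binary.PropositionalEquality using (_≡_; _≢_)
open import Relation.Nullary using (¬_)
open import Function.Definitions using (Injective)

record Graph (n : ℕ) : Set₁ where
  field
    Adj     : Fin n → Fin n → Set
    sym     : ∀ {x y} → Adj x y → Adj y x
    irrefl  : ∀ {x} → ¬ Adj x x

open Graph public

data Walk {n : ℕ} (G : Graph n) : Fin n → Fin n → ℕ → Set where
  here : ∀ {x} → Walk G x x zero
  step : ∀ {x y z m} → Adj G x y → Walk G y z m → Walk G x z (suc m)

Connected : ∀ {n} → Graph n → Set
Connected G = ∀ x y → ∃ λ m → Walk G x y m

Dist : ∀ {n} → Graph n → Fin n → Fin n → ℕ → Set
Dist G x y m = Walk G x y m × (∀ m' → Walk G x y m' → m ≤ m')

Complete : ∀ {n} → Graph n → Set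
Complete G = ∀ x y → x ≢ y → Adj G x y

Distinguishes : ∀ {n} → Graph n → Fin n → Fin n → Fin n → Set
Distinguishes G w x y = ∀ a b → Dist G x w a → Dist G y w b → a ≢ b

AtLeastDistinguish : ∀ {n} → Graph n → ℕ → Subset n → Fin n → Fin n → Set
AtLeastDistinguish {n} G k S x y =
  Σ (Fin k → Fin n) λ f → Injective _≡_ _≡_ f ×
    (∀ i → (f i ∈ S) × Distinguishes G (f i) x y)

IsKMetricGenerator : ∀ {n} → Graph n → ℕ → Subset n → Set
IsKMetricGenerator G k S = ∀ x y → x ≢ y → AtLeastDistinguish G k S x y

KMetricDimensional : ∀ {n} → Graph n → ℕ → Set
KMetricDimensional {n} G k =
  (Σ (Subset n) λ S → IsKMetricGenerator G k S) ×
  (∀ k' → Σ (Subset n) (IsKMetricGenerator G k') → k' ≤ k)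

Clique : ∀ {n} → Graph n → ℕ → Set
Clique {n} G w = Σ (Fin w → Fin n) λ f → Injective _≡_ _≡_ f ×
  (∀ i j → i ≢ j → Adj G (f i) (f j))

IsCliqueNumber : ∀ {n} → Graph n → ℕ → Set
IsCliqueNumber G w = Clique G w × (∀ w' → Clique G w' → w' ≤ w)

module Submission where

-- Call a pair of distinct vertices x, y together with m distinct
-- vertices none of which distinguishes x from y an "undistinguished pair of
-- weight m".  A k-metric generator must supply k distinguishers of x, y, all
-- different from those m vertices, hence k + m ≤ n.  So it suffices to find an
-- undistinguished pair of weight ω - 1 (or of weight 1 when ω ≤ 2):
--   * ω ≤ 2: a connected non-complete graph has an induced path a - b - c, and
--     b does not distinguish a from c;
--   * ω ≥ 3: since G is connected and not complete, some vertex x outside a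
--     clique K of size ω is adjacent to a clique vertex u.  Either x is also
--     adjacent to another clique vertex v (then x and K - {u, v} do not
--     distinguish u, v), or x is non-adjacent to two clique vertices v, w (then
--     d(v, x) = d(w, x) = 2 and x together with K - {v, w} do not distinguish
--     v, w).  Either way we get weight 1 + (ω - 2) = ω - 1.
-- Adjacency is not decidable, so the case analyses take place in the
-- double-negation monad; the conclusion k ≤ n ∸ ω + 1 is decidable, which
-- lets us leave the monad at the end.

open import Defs
open import Data.Nat using (ℕ; zero; suc; _≤_; _∸_; _+_; z≤n; s≤s; _<_; _≤?_; pred)
import Data.Nat.Properties as ℕ
open import Data.Fin using (Fin; splitAt; join; punchIn; punchOut)
import Data.Fin.Properties as Fin
open import Data.Fin.Subset using (Subset)
open import Data.Vec.Functional using (_∷_)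
open import Data.Product using (Σ; ∃; _×_; _,_; proj₂)
open import Data.Sum using (inj₁; inj₂; [_,_]′)
open import Data.Empty using (⊥; ⊥-elim)
open import Effect.Monad using (RawMonad)
open import Function using (_∘_)
open import Function.Definitions using (Injective)
open import Relation.Binary.PropositionalEquality
  using (_≡_; _≢_; refl; cong; subst; trans; module ≡-Reasoning)
  renaming (sym to ≡-sym)
open import Relation.Nullary using (¬_; Dec; yes; no)
open import Relation.Nullary.Decidable.Core using (decidable-stable; ¬¬-excluded-middle)
open import Relation.Nullary.Negation using (¬¬-Monad; ¬¬-map; ¬∃⟶∀¬; negated-stable)
open import Level using (0ℓ)

open RawMonad (¬¬-Monad {0ℓ}) using (return; _>>=_)

-- Double-negation shift over a finite index type; it is what allows a
-- classical choice of a non-edge in a non-complete graph.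
¬¬-∀-Fin : ∀ {m} {P : Fin m → Set} → (∀ i → ¬ ¬ P i) → ¬ ¬ (∀ i → P i)
¬¬-∀-Fin {zero}  ¬¬P ¬∀P = ¬∀P (λ ())
¬¬-∀-Fin {suc m} ¬¬P ¬∀P =
  ¬¬P Fin.zero λ P₀ → ¬¬-∀-Fin (¬¬P ∘ Fin.suc) λ P₊ →
    ¬∀P λ { Fin.zero → P₀ ; (Fin.suc i) → P₊ i }

¬∀⇒¬¬∃¬ : ∀ {m} {P : Fin m → Set} → ¬ (∀ i → P i) → ¬ ¬ ∃ λ i → ¬ P i
¬∀⇒¬¬∃¬ ¬∀P ¬∃¬P = ¬¬-∀-Fin (¬∃⟶∀¬ ¬∃¬P) ¬∀P

splitAt-injective : ∀ k {m} → Injective _≡_ _≡_ (splitAt k {m})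
splitAt-injective k {m} {i} {j} eq = begin
  i                      ≡⟨ ≡-sym (Fin.join-splitAt k m i) ⟩
  join k m (splitAt k i) ≡⟨ cong (join k m) eq ⟩
  join k m (splitAt k j) ≡⟨ Fin.join-splitAt k m j ⟩
  j                      ∎
  where open ≡-Reasoning

disjoint-families-bound : ∀ {n k m} {P : Fin n → Set}
  (f : Fin k → Fin n) (g : Fin m → Fin n) → Injective _≡_ _≡_ f → Injective _≡_ _≡_ g
  → (∀ i → P (f i)) → (∀ j → ¬ P (g j)) → k + m ≤ n
disjoint-families-bound {k = k} {P = P} f g f-inj g-inj Pf ¬Pg =
  Fin.injective⇒≤ (λ eq → splitAt-injective k (joint-injective _ _ eq))
  where
  joint-injective : ∀ u v → [ f , g ]′ u ≡ [ f , g ]′ v → u ≡ v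
  joint-injective (inj₁ i) (inj₁ i′) eq = cong inj₁ (f-inj eq)
  joint-injective (inj₁ i) (inj₂ j)  eq = ⊥-elim (¬Pg j (subst P eq (Pf i)))
  joint-injective (inj₂ j) (inj₁ i)  eq = ⊥-elim (¬Pg j (subst P (≡-sym eq) (Pf i)))
  joint-injective (inj₂ j) (inj₂ j′) eq = cong inj₂ (g-inj eq)

∷-injective : ∀ {n m} {x : Fin n} {g : Fin m → Fin n} → Injective _≡_ _≡_ g
  → (∀ j → g j ≢ x) → Injective _≡_ _≡_ (x ∷ g)
∷-injective g-inj g≢x {Fin.zero}  {Fin.zero}  eq = refl
∷-injective g-inj g≢x {Fin.zero}  {Fin.suc j} eq = ⊥-elim (g≢x j (≡-sym eq))
∷-injective g-inj g≢x {Fin.suc i} {Fin.zero}  eq = ⊥-elim (g≢x i eq)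
∷-injective g-inj g≢x {Fin.suc i} {Fin.suc j} eq = cong Fin.suc (g-inj eq)

skip-two : ∀ {s} (p q : Fin (suc (suc s))) → p ≢ q
  → Σ (Fin s → Fin (suc (suc s))) λ e →
      Injective _≡_ _≡_ e × (∀ j → e j ≢ p) × (∀ j → e j ≢ q)
skip-two {s} p q p≢q = e , e-inj , e≢p , e≢q
  where
  q′ : Fin (suc s)
  q′ = punchOut p≢q
  e : Fin s → Fin (suc (suc s))
  e j = punchIn p (punchIn q′ j)
  e-inj : Injective _≡_ _≡_ e
  e-inj eq = Fin.punchIn-injective q′ _ _ (Fin.punchIn-injective p _ _ eq)
  e≢p : ∀ j → e j ≢ p
  e≢p j = Fin.punchInᵢ≢i p _
  e≢q : ∀ j → e j ≢ q
  e≢q j eq = Fin.punchInᵢ≢i q′ j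
    (Fin.punchIn-injective p _ _ (trans eq (≡-sym (Fin.punchIn-punchOut p≢q))))

two-others : ∀ {r} (u : Fin (suc (suc (suc r))))
  → Σ (Fin (suc (suc (suc r)))) λ a → Σ (Fin (suc (suc (suc r)))) λ b → a ≢ u × b ≢ u × a ≢ b
two-others u = punchIn u Fin.zero , punchIn u (Fin.suc Fin.zero)
             , Fin.punchInᵢ≢i u _ , Fin.punchInᵢ≢i u _ , zero≢one ∘ Fin.punchIn-injective u _ _
  where
  zero≢one : ∀ {r} → Fin.zero {suc r} ≢ Fin.suc Fin.zero
  zero≢one ()

∸-pred-≤ : ∀ n ω → n ∸ pred ω ≤ n ∸ ω + 1
∸-pred-≤ n       zero          = ℕ.m≤m+n n 1
∸-pred-≤ zero    (suc ω)       = ℕ.≤-trans (ℕ.m∸n≤m 0 ω) z≤n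
∸-pred-≤ (suc n) (suc zero)    = ℕ.≤-reflexive (ℕ.+-comm 1 n)
∸-pred-≤ (suc n) (suc (suc ω)) = ∸-pred-≤ n (suc ω)

capacity-bound : ∀ {n k m ω} → k + m ≤ n → ω ≤ suc m → k ≤ n ∸ ω + 1
capacity-bound {n} {k} {ω = ω} k+m≤n ω≤1+m = ℕ.≤-trans (ℕ.m+n≤o⇒m≤o∸n k k+m≤n)
  (ℕ.≤-trans (ℕ.∸-monoʳ-≤ n (ℕ.pred-mono-≤ ω≤1+m)) (∸-pred-≤ n ω))

module _ {n : ℕ} (G : Graph n) where

  record UndistinguishedPair (m : ℕ) : Set where
    field
      x y          : Fin n
      x≢y          : x ≢ y
      witnesses    : Fin m → Fin n
      witnesses-injective : Injective _≡_ _≡_ witnesses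
      undistinguishing    : ∀ j → ¬ Distinguishes G (witnesses j) x y

  generator-bound : ∀ {k m} {S : Subset n} → IsKMetricGenerator G k S
    → UndistinguishedPair m → k + m ≤ n
  generator-bound gen u =
    let f , f-inj , f-dist = gen x y x≢y
    in disjoint-families-bound {P = λ w → Distinguishes G w x y} f witnesses
         f-inj witnesses-injective (proj₂ ∘ f-dist) undistinguishing
    where open UndistinguishedPair u

  equidistant⇒¬distinguishes : ∀ {x y w d} → Dist G x w d → Dist G y w d
    → ¬ Distinguishes G w x y
  equidistant⇒¬distinguishes dx dy distinguishes = distinguishes _ _ dx dy refl

  walk₀⇒≡ : ∀ {x y} → Walk G x y 0 → x ≡ y
  walk₀⇒≡ here = refl

  walk₁⇒adj : ∀ {x y} → Walk G x y 1 → Adj G x y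
  walk₁⇒adj (step x~y here) = x~y

  adj⇒dist₁ : ∀ {x y} → Adj G x y → Dist G x y 1
  adj⇒dist₁ {x} x~y = step x~y here , shortest
    where
    shortest : ∀ m → Walk G _ _ m → 1 ≤ m
    shortest zero    w = ⊥-elim (irrefl G (subst (Adj G x) (≡-sym (walk₀⇒≡ w)) x~y))
    shortest (suc m) _ = s≤s z≤n

  common-neighbour⇒dist₂ : ∀ {x z y} → Adj G x z → Adj G z y → x ≢ y → ¬ Adj G x y
    → Dist G x y 2
  common-neighbour⇒dist₂ x~z z~y x≢y x≁y = step x~z (step z~y here) , shortest
    where
    shortest : ∀ m → Walk G _ _ m → 2 ≤ m
    shortest zero          w = ⊥-elim (x≢y (walk₀⇒≡ w))
    shortest (suc zero)    w = ⊥-elim (x≁y (walk₁⇒adj w))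
    shortest (suc (suc m)) _ = s≤s (s≤s z≤n)

  record InducedPath₃ : Set where
    field
      a b c : Fin n
      a~b   : Adj G a b
      b~c   : Adj G b c
      a≢c   : a ≢ c
      a≁c   : ¬ Adj G a c

  induced-path⇒undistinguished : InducedPath₃ → UndistinguishedPair 1
  induced-path⇒undistinguished path = record
    { x = a ; y = c ; x≢y = a≢c
    ; witnesses = λ _ → b
    ; witnesses-injective = λ { {Fin.zero} {Fin.zero} _ → refl }
    ; undistinguishing = λ _ → equidistant⇒¬distinguishes (adj⇒dist₁ a~b) (adj⇒dist₁ (sym G b~c))
    }
    where open InducedPath₃ path

  ¬complete⇒non-edge : ¬ Complete G → ¬ ¬ (Σ (Fin n) λ p → Σ (Fin n) λ q → p ≢ q × ¬ Adj G p q)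
  ¬complete⇒non-edge ¬complete = do
    p , ¬∀q ← ¬∀⇒¬¬∃¬ ¬complete
    q , ¬[p≢q⇒p~q] ← ¬∀⇒¬¬∃¬ ¬∀q
    return (p , q , negated-stable (λ ¬p≢q → ¬[p≢q⇒p~q] (⊥-elim ∘ ¬p≢q))
                  , λ p~q → ¬[p≢q⇒p~q] (λ _ → p~q))

  -- Walk from p towards a non-adjacent q: if the next vertex y is adjacent to q
  -- then p - y - q is induced, otherwise continue from y (still non-adjacent to q).
  walk⇒induced-path : ∀ {p q m} → Walk G p q m → p ≢ q → ¬ Adj G p q → ¬ ¬ InducedPath₃
  walk⇒induced-path here p≢q _ = ⊥-elim (p≢q refl)
  walk⇒induced-path {p} {q} (step {y = y} p~y rest) p≢q p≁q = ¬¬-excluded-middle >>= λ where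
    (yes y~q) → return (record { a = p ; b = y ; c = q ; a~b = p~y ; b~c = y~q ; a≢c = p≢q ; a≁c = p≁q })
    (no y≁q)  → walk⇒induced-path rest (λ y≡q → p≁q (subst (Adj G p) y≡q p~y)) y≁q

  connected-non-complete⇒induced-path : Connected G → ¬ Complete G → ¬ ¬ InducedPath₃
  connected-non-complete⇒induced-path connected ¬complete = do
    p , q , p≢q , p≁q ← ¬complete⇒non-edge ¬complete
    walk⇒induced-path (proj₂ (connected p q)) p≢q p≁q

  module CliqueArgument {s : ℕ} (c : Fin (suc (suc s)) → Fin n)
      (c-injective : Injective _≡_ _≡_ c)
      (c-adjacent : ∀ i j → i ≢ j → Adj G (c i) (c j)) where

    InClique : Fin n → Set
    InClique z = ∃ λ i → c i ≡ z

    -- Membership is decidable, so this needs no classical reasoning.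
    outside-vertex : ¬ Complete G → ∃ λ z → ¬ InClique z
    outside-vertex ¬complete =
      Fin.¬∀⟶∃¬ n InClique (λ z → Fin.any? (λ i → c i Fin.≟ z)) (¬complete ∘ complete)
      where
      complete : (∀ z → InClique z) → Complete G
      complete all x y x≢y with all x | all y
      ... | i , refl | j , refl = c-adjacent i j (x≢y ∘ cong c)

    boundary-edge : ∀ {p q m} → Walk G p q m → ¬ InClique p → InClique q
      → Σ (Fin n) λ x → ¬ InClique x × ∃ λ i → Adj G x (c i)
    boundary-edge here p∉ q∈ = ⊥-elim (p∉ q∈)
    boundary-edge {p} (step {y = y} p~y rest) p∉ q∈ with Fin.any? (λ i → c i Fin.≟ y)
    ... | yes (i , refl) = p , p∉ , i , p~y
    ... | no y∉          = boundary-edge rest y∉ q∈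

    -- The key construction: if an outside vertex x is equidistant from two
    -- clique vertices c p, c q, then x and the s other clique vertices do not
    -- distinguish c p from c q (each other clique vertex is adjacent to both).
    equidistant-outsider : ∀ {p q x d} → p ≢ q → ¬ InClique x
      → Dist G (c p) x d → Dist G (c q) x d → UndistinguishedPair (suc s)
    equidistant-outsider {p} {q} {x} p≢q x∉ dp dq =
      let e , e-inj , e≢p , e≢q = skip-two p q p≢q in record
      { x = c p ; y = c q ; x≢y = p≢q ∘ c-injective
      ; witnesses = x ∷ (c ∘ e)
      ; witnesses-injective = ∷-injective (e-inj ∘ c-injective) (λ j cej≡x → x∉ (e j , cej≡x))
      ; undistinguishing = λ where
          Fin.zero    → equidistant⇒¬distinguishes dp dq
          (Fin.suc j) → equidistant⇒¬distinguishes
            (adj⇒dist₁ (c-adjacent p (e j) (e≢p j ∘ ≡-sym)))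
            (adj⇒dist₁ (c-adjacent q (e j) (e≢q j ∘ ≡-sym)))
      }

    outsider-with-clique-neighbour : Connected G → ¬ Complete G
      → Σ (Fin n) λ x → ¬ InClique x × ∃ λ i → Adj G x (c i)
    outsider-with-clique-neighbour connected ¬complete =
      let z , z∉ = outside-vertex ¬complete
      in boundary-edge (proj₂ (connected z (c Fin.zero))) z∉ (Fin.zero , refl)

    -- An outside vertex x adjacent to c u is adjacent to c a, or to c b, or at
    -- distance 2 from both; in each case it is equidistant from two clique vertices.
    outsider⇒undistinguished : ∀ {x u a b} → ¬ InClique x → Adj G x (c u)
      → a ≢ u → b ≢ u → a ≢ b → ¬ ¬ UndistinguishedPair (suc s)
    outsider⇒undistinguished {x} {u} {a} {b} x∉ x~u a≢u b≢u a≢b = do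
      x~a? ← ¬¬-excluded-middle
      x~b? ← ¬¬-excluded-middle
      return (by-cases x~a? x~b?)
      where
      u~x : Dist G (c u) x 1
      u~x = adj⇒dist₁ (sym G x~u)
      at-distance-2 : ∀ {v} → v ≢ u → ¬ Adj G x (c v) → Dist G (c v) x 2
      at-distance-2 {v} v≢u x≁v = common-neighbour⇒dist₂ (c-adjacent v u v≢u) (sym G x~u)
        (λ cv≡x → x∉ (v , cv≡x)) (x≁v ∘ sym G)
      by-cases : Dec (Adj G x (c a)) → Dec (Adj G x (c b)) → UndistinguishedPair (suc s)
      by-cases (yes x~a) _ =
        equidistant-outsider (a≢u ∘ ≡-sym) x∉ u~x (adj⇒dist₁ (sym G x~a))
      by-cases (no _) (yes x~b) =
        equidistant-outsider (b≢u ∘ ≡-sym) x∉ u~x (adj⇒dist₁ (sym G x~b))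
      by-cases (no x≁a) (no x≁b) =
        equidistant-outsider a≢b x∉ (at-distance-2 a≢u x≁a) (at-distance-2 b≢u x≁b)

  clique⇒undistinguished : ∀ {r} → Connected G → ¬ Complete G → Clique G (suc (suc (suc r)))
    → ¬ ¬ UndistinguishedPair (suc (suc r))
  clique⇒undistinguished connected ¬complete (c , c-injective , c-adjacent) =
    let x , x∉ , u , x~u = outsider-with-clique-neighbour connected ¬complete
        a , b , a≢u , b≢u , a≢b = two-others u
    in outsider⇒undistinguished x∉ x~u a≢u b≢u a≢b
    where open CliqueArgument c c-injective c-adjacent

  clique⇒heavy-undistinguished-pair : ∀ {ω} → Connected G → ¬ Complete G → Clique G ω
    → ¬ ¬ (∃ λ m → ω ≤ suc m × UndistinguishedPair m)
  clique⇒heavy-undistinguished-pair {ω} connected ¬complete clique with ω ≤? 2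
  ... | yes ω≤2 = ¬¬-map (λ path → 1 , ω≤2 , induced-path⇒undistinguished path)
                    (connected-non-complete⇒induced-path connected ¬complete)
  ... | no ω≰2 = large-clique (ℕ.≰⇒> ω≰2) clique
    where
    large-clique : ∀ {ω} → 2 < ω → Clique G ω → ¬ ¬ (∃ λ m → ω ≤ suc m × UndistinguishedPair m)
    large-clique (s≤s (s≤s (s≤s _))) clique =
      ¬¬-map (λ pair → _ , ℕ.≤-refl , pair) (clique⇒undistinguished connected ¬complete clique)

  generator-clique-bound : ∀ {k ω} {S : Subset n} → Connected G → ¬ Complete G
    → IsKMetricGenerator G k S → Clique G ω → k ≤ n ∸ ω + 1
  generator-clique-bound {k} {ω} connected ¬complete generator clique =
    decidable-stable (k ≤? n ∸ ω + 1)
      (¬¬-map (λ (_ , ω≤1+m , pair) → capacity-bound (generator-bound generator pair) ω≤1+m)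
              (clique⇒heavy-undistinguished-pair connected ¬complete clique))

theorem10 : (n : ℕ) (G : Graph n) → Connected G → (Complete G → ⊥)
    → (k ω : ℕ) → KMetricDimensional G k → IsCliqueNumber G ω
    → k ≤ n ∸ ω + 1
theorem10 n G connected ¬complete k ω ((_ , generator) , _) (clique , _) =
  generator-clique-bound G connected ¬complete generator clique
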